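{- Every deterministic online algorithm for $1|\textrm{online- }r_{i},h_{i},p_i=1|\sum U_{i}$ has competitive ratio at least $2$; that is, for every deterministic online algorithm $\mathcal A$ and every $c<2$ there is an instance on which the number of jobs completed by an optimal offline feasible schedule exceeds $c$ times the number of jobs completed by $\mathcal A$.
   Context: An instance consists of $n$ unit-length jobs; job $j$ is given by a triple $(r_j,d_j,h_j)\in\mathbb N\times\mathbb N\times\mathbb Q$ (release time, deadline, heat contribution). Time is divided into unit slots; a schedule assigns some of the jobs to distinct integer times $u$, and job $j$ may be executed at time $u$ only if $r_j\le u$ and $u+1\le d_j$; each slot runs at most one job, otherwise it is idle. The temperature $\tau_u$ at time $u$ satisfies $\tau_0=0$, $\tau_{u+1}=(\tau_u+h_j)/2$ if job $j$ runs at time $u$, and $\tau_{u+1}=\tau_u/2$ if the slot is idle. Feasibility requires the temperature never to exceed $1$ (job $j$ cannot run at time $u$ if $\tau_u+h_j>2$). The goal is to maximize the number of completed jobs. In the online version $1|\textrm{online- }r_{i},h_{i},p_i=1|\sum U_{i}$, each job becomes known to the algorithm only at its release time, and the algorithm's decision at time $u$ may depend only on jobs with $r_j\le u$. The competitive ratio of an online algorithm is the infimum of the $c$ such that on every instance the optimal offline throughput is at most $c$ times the algorithm's throughput. -}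

module Defs where

open import Data.Nat as ℕ using (ℕ; zero; suc; _⊔_)
open import Data.Integer using (+_)
open import Data.Rational using (ℚ; _+_; _*_; _≤_; ½; 0ℚ; _/_)
open import Data.Fin using (Fin)
open import Data.List using (List; []; _∷_; length; lookup; map; filter; allFin; upTo; catMaybes; foldr)
open import Data.List.Relation.Unary.Unique.Propositional using (Unique)
open import Data.Maybe using (Maybe; just; nothing; _>>=_)
open import Data.Product using (_×_)
open import Data.Unit using (⊤)

-- A unit-length job: release time r, deadline d, heat contribution h.
record Job : Set where
  constructor job
  field
    r : ℕ
    d : ℕ
    h : ℚ
open Job public

Instance : Set
Instance = List Job

JobId : Instance → Set
JobId I = Fin (length I)

-- A schedule: the u-th entry says what runs in slot u (nothing = idle);
-- every slot beyond the end of the list is idle.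
Schedule : Instance → Set
Schedule I = List (Maybe (JobId I))

ℕtoℚ : ℕ → ℚ
ℕtoℚ n = + n / 1

2ℚ : ℚ
2ℚ = ℕtoℚ 2

-- Feasibility of the remaining schedule starting at slot u with
-- current temperature τ (τ = temperature at time u).
FeasibleFrom : (I : Instance) → ℕ → ℚ → Schedule I → Set
FeasibleFrom I u τ [] = ⊤
FeasibleFrom I u τ (nothing ∷ S) = FeasibleFrom I (suc u) (½ * τ) S
FeasibleFrom I u τ (just j ∷ S) =
  (r (lookup I j) ℕ.≤ u) × (suc u ℕ.≤ d (lookup I j)) ×
  (τ + h (lookup I j) ≤ 2ℚ) ×
  FeasibleFrom I (suc u) (½ * (τ + h (lookup I j))) S

Feasible : (I : Instance) → Schedule I → Set
Feasible I S = Unique (catMaybes S) × FeasibleFrom I 0 0ℚ S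

throughput : (I : Instance) → Schedule I → ℕ
throughput I S = length (catMaybes S)

revealedIds : (I : Instance) → ℕ → List (JobId I)
revealedIds I u = filter (λ j → r (lookup I j) ℕ.≤? u) (allFin (length I))

revealed : Instance → ℕ → List Job
revealed I u = map (lookup I) (revealedIds I u)

nth : {A : Set} → List A → ℕ → Maybe A
nth []       _       = nothing
nth (x ∷ xs) zero    = just x
nth (x ∷ xs) (suc n) = nth xs n

-- A deterministic online algorithm: at time u it sees only u and the
-- list of jobs released so far (their data, in a fixed order) and
-- returns the position in that list of the job to run, or nothing
-- to idle.  (It can recompute its own earlier decisions, since the
-- list at time u' ≤ u is a sublist of the list at time u.)
-- An out-of-range position is treated as idling.
OnlineAlgorithm : Set
OnlineAlgorithm = ℕ → List Job → Maybe ℕ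

-- Horizon: the largest deadline; no job can run at a slot ≥ horizon.
horizon : Instance → ℕ
horizon I = foldr _⊔_ 0 (map d I)

run : OnlineAlgorithm → (I : Instance) → Schedule I
run A I = map (λ u → A u (revealed I u) >>= nth (revealedIds I u)) (upTo (horizon I))

-- A single job `long` (released at 0, deadline 3, heat 1) is the only job the
-- algorithm sees up to time t.  If it first starts `long` at some t ≤ 2, the
-- adversary releases at t + 1 an urgent job with deadline t + 2 and heat 7/4:
-- right after `long` the temperature is 1/2 and 1/2 + 7/4 > 2, so the algorithm
-- completes one job while an optimal schedule, keeping `long` away from slot t,
-- completes both.  If the algorithm never starts `long` before its deadline it
-- completes nothing, while the optimum completes `long`.
module Submission where

open import Defs
open import Data.Rational using (ℚ; _*_; _<_)
open import Data.Product using (Σ; _×_; _,_)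

open import Data.Nat as ℕ using (ℕ; zero; suc; z≤n; s≤s)
open import Data.Integer using (+_)
open import Data.Rational as ℚ using (1ℚ; _≤_; _≤?_; _<?_)
open import Data.Rational.Properties using (*-zeroʳ; *-identityʳ)
open import Data.Fin using (Fin; zero; suc)
open import Data.List using ([]; _∷_; _++_; replicate)
open import Data.List.Relation.Unary.All using ([]; _∷_)
open import Data.List.Relation.Unary.AllPairs using ([]; _∷_)
open import Data.Maybe using (Maybe; just; nothing; _>>=_)
open import Data.Maybe.Properties using (≡-dec)
open import Data.Unit using (tt)
open import Data.Empty using (⊥-elim)
open import Relation.Nullary using (Dec; yes; no; ¬_)
open import Relation.Nullary.Decidable using (True; False; toWitness; toWitnessFalse)
open import Relation.Binary.PropositionalEquality using (_≡_; refl; subst; sym)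

≤-by-computation : (p q : ℚ) → True (p ≤? q) → p ≤ q
≤-by-computation _ _ = toWitness

≰-by-computation : (p q : ℚ) → False (p ≤? q) → ¬ p ≤ q
≰-by-computation _ _ = toWitnessFalse

long : Job
long = job 0 3 1ℚ

urgent : ℕ → Job
urgent t = job (suc t) (suc (suc t)) (+ 7 ℚ./ 4)

trap : ℕ → Instance
trap t = long ∷ urgent t ∷ []

lone : Instance
lone = long ∷ []

Beaten : OnlineAlgorithm → ℚ → Set
Beaten A c = Σ Instance (λ I → Σ (Schedule I) (λ S →
  Feasible I S × (c * ℕtoℚ (throughput I (run A I)) < ℕtoℚ (throughput I S))))

-- At times u ≤ t, `long` is the only job released in `trap t` (and in `lone`),
-- so the algorithm's slot u is decided by A u (long ∷ []); answers other than
-- just 0 mean idling.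
StartsLong : OnlineAlgorithm → ℕ → Set
StartsLong A u = A u (long ∷ []) ≡ just 0

startsLong? : (A : OnlineAlgorithm) (u : ℕ) → Dec (StartsLong A u)
startsLong? A u = ≡-dec ℕ._≟_ (A u (long ∷ [])) (just 0)

nth-singleton-0 : {X : Set} {x : X} {m : Maybe ℕ} → m ≡ just 0 → (m >>= nth (x ∷ [])) ≡ just x
nth-singleton-0 refl = refl

nth-singleton-≢0 : {X : Set} {x : X} (m : Maybe ℕ) → ¬ m ≡ just 0 → (m >>= nth (x ∷ [])) ≡ nothing
nth-singleton-≢0 nothing        _   = refl
nth-singleton-≢0 (just zero)    m≢0 = ⊥-elim (m≢0 refl)
nth-singleton-≢0 (just (suc _)) _   = refl

slot : (A : OnlineAlgorithm) (I : Instance) → ℕ → Maybe (JobId I)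
slot A I u = A u (revealed I u) >>= nth (revealedIds I u)

-- Feasible schedules of a trap that start `long` at slot t complete at most one
-- job: `long` cannot run twice, and the urgent job can only run at slot t + 1,
-- where it is too hot.
trap₀-throughput-≤1 : (s₀ s₁ s₂ : Maybe (Fin 2)) → s₀ ≡ just zero →
  Feasible (trap 0) (s₀ ∷ s₁ ∷ s₂ ∷ []) → throughput (trap 0) (s₀ ∷ s₁ ∷ s₂ ∷ []) ℕ.≤ 1
trap₀-throughput-≤1 _ nothing           nothing           refl _ = s≤s z≤n
trap₀-throughput-≤1 _ nothing           (just zero)       refl ((twice ∷ _) ∷ _ , _) = ⊥-elim (twice refl)
trap₀-throughput-≤1 _ nothing           (just (suc zero)) refl (_ , _ , _ , _ , _ , s≤s (s≤s ()) , _)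
trap₀-throughput-≤1 _ (just zero)       _                 refl ((twice ∷ _) ∷ _ , _) = ⊥-elim (twice refl)
trap₀-throughput-≤1 _ (just (suc zero)) _                 refl (_ , _ , _ , _ , _ , _ , hot , _) =
  ⊥-elim (≰-by-computation _ _ tt hot)

trap₁-throughput-≤1 : (s₀ s₁ s₂ : Maybe (Fin 2)) → s₀ ≡ nothing → s₁ ≡ just zero →
  Feasible (trap 1) (s₀ ∷ s₁ ∷ s₂ ∷ []) → throughput (trap 1) (s₀ ∷ s₁ ∷ s₂ ∷ []) ℕ.≤ 1
trap₁-throughput-≤1 _ _ nothing           refl refl _ = s≤s z≤n
trap₁-throughput-≤1 _ _ (just zero)       refl refl ((twice ∷ _) ∷ _ , _) = ⊥-elim (twice refl)
trap₁-throughput-≤1 _ _ (just (suc zero)) refl refl (_ , _ , _ , _ , _ , _ , hot , _) =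
  ⊥-elim (≰-by-computation _ _ tt hot)

trap₂-throughput-≤1 : (s₀ s₁ s₂ s₃ : Maybe (Fin 2)) → s₀ ≡ nothing → s₁ ≡ nothing → s₂ ≡ just zero →
  Feasible (trap 2) (s₀ ∷ s₁ ∷ s₂ ∷ s₃ ∷ []) → throughput (trap 2) (s₀ ∷ s₁ ∷ s₂ ∷ s₃ ∷ []) ℕ.≤ 1
trap₂-throughput-≤1 _ _ _ nothing           refl refl refl _ = s≤s z≤n
trap₂-throughput-≤1 _ _ _ (just zero)       refl refl refl ((twice ∷ _) ∷ _ , _) = ⊥-elim (twice refl)
trap₂-throughput-≤1 _ _ _ (just (suc zero)) refl refl refl (_ , _ , _ , _ , _ , _ , hot , _) =
  ⊥-elim (≰-by-computation _ _ tt hot)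

lone-idle-throughput-≡0 : (s₀ s₁ s₂ : Maybe (Fin 1)) → s₀ ≡ nothing → s₁ ≡ nothing → s₂ ≡ nothing →
  throughput lone (s₀ ∷ s₁ ∷ s₂ ∷ []) ≡ 0
lone-idle-throughput-≡0 _ _ _ refl refl refl = refl

urgent-then-long : Schedule (trap 0)
urgent-then-long = nothing ∷ just (suc zero) ∷ just zero ∷ []

urgent-then-long-feasible : Feasible (trap 0) urgent-then-long
urgent-then-long-feasible =
  ((λ ()) ∷ []) ∷ [] ∷ [] ,
  s≤s z≤n , s≤s (s≤s z≤n) , ≤-by-computation _ _ tt ,
  z≤n , s≤s (s≤s (s≤s z≤n)) , ≤-by-computation _ _ tt , tt

long-then-urgent : (t : ℕ) → Schedule (trap t)
long-then-urgent t = just zero ∷ replicate t nothing ++ just (suc zero) ∷ []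

long-then-urgent₁-feasible : Feasible (trap 1) (long-then-urgent 1)
long-then-urgent₁-feasible =
  ((λ ()) ∷ []) ∷ [] ∷ [] ,
  z≤n , s≤s z≤n , ≤-by-computation _ _ tt ,
  s≤s (s≤s z≤n) , s≤s (s≤s (s≤s z≤n)) , ≤-by-computation _ _ tt , tt

long-then-urgent₂-feasible : Feasible (trap 2) (long-then-urgent 2)
long-then-urgent₂-feasible =
  ((λ ()) ∷ []) ∷ [] ∷ [] ,
  z≤n , s≤s z≤n , ≤-by-computation _ _ tt ,
  s≤s (s≤s (s≤s z≤n)) , s≤s (s≤s (s≤s (s≤s z≤n))) , ≤-by-computation _ _ tt , tt

long-now : Schedule lone
long-now = just zero ∷ []

long-now-feasible : Feasible lone long-now
long-now-feasible = [] ∷ [] , z≤n , s≤s z≤n , ≤-by-computation _ _ tt , tt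

scaled-≤1-<2 : {c : ℚ} → c < 2ℚ → {n : ℕ} → n ℕ.≤ 1 → c * ℕtoℚ n < ℕtoℚ 2
scaled-≤1-<2 {c} _   z≤n       = subst (_< ℕtoℚ 2) (sym (*-zeroʳ c)) (toWitness {a? = ℚ.0ℚ <? ℕtoℚ 2} tt)
scaled-≤1-<2 {c} c<2 (s≤s z≤n) = subst (_< ℕtoℚ 2) (sym (*-identityʳ c)) c<2

scaled-0-<1 : (c : ℚ) → c * ℕtoℚ 0 < ℕtoℚ 1
scaled-0-<1 c = subst (_< ℕtoℚ 1) (sym (*-zeroʳ c)) (toWitness {a? = ℚ.0ℚ <? 1ℚ} tt)

module _ (A : OnlineAlgorithm) where

  run-trap₀-≤1 : Feasible (trap 0) (run A (trap 0)) → StartsLong A 0 →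
    throughput (trap 0) (run A (trap 0)) ℕ.≤ 1
  run-trap₀-≤1 feasible s₀ =
    trap₀-throughput-≤1 (slot A (trap 0) 0) (slot A (trap 0) 1) (slot A (trap 0) 2)
      (nth-singleton-0 s₀) feasible

  run-trap₁-≤1 : Feasible (trap 1) (run A (trap 1)) → ¬ StartsLong A 0 → StartsLong A 1 →
    throughput (trap 1) (run A (trap 1)) ℕ.≤ 1
  run-trap₁-≤1 feasible i₀ s₁ =
    trap₁-throughput-≤1 (slot A (trap 1) 0) (slot A (trap 1) 1) (slot A (trap 1) 2)
      (nth-singleton-≢0 (A 0 (long ∷ [])) i₀) (nth-singleton-0 s₁) feasible

  run-trap₂-≤1 : Feasible (trap 2) (run A (trap 2)) →
    ¬ StartsLong A 0 → ¬ StartsLong A 1 → StartsLong A 2 →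
    throughput (trap 2) (run A (trap 2)) ℕ.≤ 1
  run-trap₂-≤1 feasible i₀ i₁ s₂ =
    trap₂-throughput-≤1 (slot A (trap 2) 0) (slot A (trap 2) 1) (slot A (trap 2) 2) (slot A (trap 2) 3)
      (nth-singleton-≢0 (A 0 (long ∷ [])) i₀) (nth-singleton-≢0 (A 1 (long ∷ [])) i₁)
      (nth-singleton-0 s₂) feasible

  run-lone-≡0 : ¬ StartsLong A 0 → ¬ StartsLong A 1 → ¬ StartsLong A 2 →
    throughput lone (run A lone) ≡ 0
  run-lone-≡0 i₀ i₁ i₂ =
    lone-idle-throughput-≡0 (slot A lone 0) (slot A lone 1) (slot A lone 2)
      (nth-singleton-≢0 (A 0 (long ∷ [])) i₀) (nth-singleton-≢0 (A 1 (long ∷ [])) i₁)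
      (nth-singleton-≢0 (A 2 (long ∷ [])) i₂)

  adversary : (c : ℚ) → c < 2ℚ → ((I : Instance) → Feasible I (run A I)) →
    Dec (StartsLong A 0) → Dec (StartsLong A 1) → Dec (StartsLong A 2) → Beaten A c
  adversary c c<2 feasible (yes s₀) _ _ = trap 0 , urgent-then-long , urgent-then-long-feasible ,
    scaled-≤1-<2 c<2 (run-trap₀-≤1 (feasible (trap 0)) s₀)
  adversary c c<2 feasible (no i₀) (yes s₁) _ = trap 1 , long-then-urgent 1 , long-then-urgent₁-feasible ,
    scaled-≤1-<2 c<2 (run-trap₁-≤1 (feasible (trap 1)) i₀ s₁)
  adversary c c<2 feasible (no i₀) (no i₁) (yes s₂) = trap 2 , long-then-urgent 2 , long-then-urgent₂-feasible ,
    scaled-≤1-<2 c<2 (run-trap₂-≤1 (feasible (trap 2)) i₀ i₁ s₂)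
  adversary c c<2 feasible (no i₀) (no i₁) (no i₂) = lone , long-now , long-now-feasible ,
    subst (λ n → c * ℕtoℚ n < ℕtoℚ 1) (sym (run-lone-≡0 i₀ i₁ i₂)) (scaled-0-<1 c)

theorem4 : (A : OnlineAlgorithm) → ((I : Instance) → Feasible I (run A I)) →
    (c : ℚ) → c < 2ℚ →
    Σ Instance (λ I → Σ (Schedule I) (λ S →
    Feasible I S × (c * ℕtoℚ (throughput I (run A I)) < ℕtoℚ (throughput I S))))
theorem4 A feasible c c<2 =
  adversary A c c<2 feasible (startsLong? A 0) (startsLong? A 1) (startsLong? A 2)
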